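{- Let $q,m,n$ be integers with $n>m$ such that one of the following holds: (a) $q=2$, $m=3$; (b) $q=3$, $m=2$; (c) $q\ge 4$, $m=1$. Then \[\sum_{k=m}^{n-1} q^{2(n-k)}\genfrac{[}{]}{0pt}{0}{n}{k}_q^2\,(q^k)!\,(q^n-q^k)!<(q^n)!.\]
   Context: $\genfrac{[}{]}{0pt}{0}{n}{k}_q=\frac{(q^n-1)(q^{n-1}-1)\cdots(q^{n-k+1}-1)}{(q^k-1)(q^{k-1}-1)\cdots(q-1)}$ is the Gaussian binomial coefficient. -}

module Defs where

open import Data.Nat using (ℕ; zero; suc; _+_; _*_; _∸_; _^_; _/_; _!)

qFallProd : ℕ → ℕ → ℕ → ℕ
qFallProd q n zero    = 1
qFallProd q n (suc k) = (q ^ (n ∸ k) ∸ 1) * qFallProd q n k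

-- division that returns 0 when the divisor is 0 (never happens for q ≥ 2)
_div_ : ℕ → ℕ → ℕ
m div zero    = 0
m div (suc d) = m / suc d

-- Gaussian binomial coefficient [n k]_q as the (exact) quotient
--   (q^n-1)(q^(n-1)-1)...(q^(n-k+1)-1) / ((q^k-1)(q^(k-1)-1)...(q-1))
gaussBinom : ℕ → ℕ → ℕ → ℕ
gaussBinom q n k = qFallProd q n k div qFallProd q k k

summand : ℕ → ℕ → ℕ → ℕ
summand q n k =
  q ^ (2 * (n ∸ k)) * (gaussBinom q n k * gaussBinom q n k)
    * ((q ^ k) !) * ((q ^ n ∸ q ^ k) !)

-- Σ_{k=m}^{n-1} f k  (empty when n ≤ m)
sumFromTo : ℕ → ℕ → (ℕ → ℕ) → ℕ
sumFromTo m zero    f = 0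
sumFromTo m (suc j) f = sumFromTo m j f + (if-le m j (f j))
  where
  if-le : ℕ → ℕ → ℕ → ℕ
  if-le zero    _       x = x
  if-le (suc a) zero    x = 0
  if-le (suc a) (suc b) x = if-le a b x

module Submission where

-- It suffices to show that 2^(k-m+1) times the k-th summand is at most (q^n)!, because these
-- budgets add up to less than (q^n)!. With a = q^k, N = q^n and d = n - k the k-th summand equals
-- q^(2d) [n k]_q^2 N! / C(N,a), so one needs an upper bound for the Gaussian binomial and a lower
-- bound for C(N,a). The crude bounds [n k]_q ≤ q^((d+1)k) and C(N,a) ≥ (N/a)^a = q^(da), together
-- with 2^(k-m+1) ≤ q^(k+1), reduce the claim to 1 + 3k + 2d + 2dk ≤ d q^k, which holds when
-- 5k+3 ≤ q^k, and for (q,k) = (2,4), (3,2) once d ≥ 3. The terms with (q,k) = (2,3) or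
-- (q ≥ 4, k = 1) need the exact denominator of the Gaussian binomial and the sharper bound
-- C(N,a) ≥ (N-a+1)^a / a!; the finitely many remaining values of n are checked by computation.

open import Defs
open import Data.Nat
open import Data.Nat.Properties
open import Data.Nat.DivMod using (m/n*n≤m)
open import Data.Nat.Solver using (module +-*-Solver)
open import Data.Sum using (_⊎_; inj₁; inj₂)
open import Data.Product using (_×_; _,_)
open import Function using (_∘_)
open import Relation.Binary.PropositionalEquality
open +-*-Solver

-- The guard inside sumFromTo is not accessible, so the step lemmas compare with the shifted sum
-- over f ∘ suc, whose last step is guarded by the same condition.
sumFromTo-suc : ∀ {m j} f → m ≤ j → sumFromTo m (suc j) f ≡ sumFromTo m j f + f j
sumFromTo-suc {zero}          f _           = refl
sumFromTo-suc {suc m} {suc j} f (s≤s m≤j) =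
  cong (sumFromTo (suc m) (suc j) f +_)
    (+-cancelˡ-≡ (sumFromTo m j (f ∘ suc)) _ _ (sumFromTo-suc (f ∘ suc) m≤j))

sumFromTo-suc-< : ∀ {m j} f → j < m → sumFromTo m (suc j) f ≡ sumFromTo m j f
sumFromTo-suc-< {suc m} {zero}  f _           = refl
sumFromTo-suc-< {suc m} {suc j} f (s≤s j<m) =
  trans (cong (sumFromTo (suc m) (suc j) f +_)
          (+-cancelˡ-≡ (sumFromTo m j (f ∘ suc)) _ 0
            (trans (sumFromTo-suc-< (f ∘ suc) j<m) (sym (+-identityʳ _)))))
        (+-identityʳ _)

sumFromTo-≤ : ∀ {m j} f → j ≤ m → sumFromTo m j f ≡ 0
sumFromTo-≤ {j = zero}  f _   = refl
sumFromTo-≤ {j = suc j} f j<m = trans (sumFromTo-suc-< f j<m) (sumFromTo-≤ f (<⇒≤ j<m))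

sumFromTo-dyadic : ∀ {m n N} f → (∀ k → m ≤ k → k < n → 2 ^ suc (k ∸ m) * f k ≤ N) →
  ∀ t → m + t ≤ n → 2 ^ t * sumFromTo m (m + t) f + N ≤ 2 ^ t * N
sumFromTo-dyadic {m} {n} {N} f bound zero _
  rewrite +-identityʳ m | sumFromTo-≤ f (≤-refl {m}) = ≤-reflexive (sym (+-identityʳ N))
sumFromTo-dyadic {m} {n} {N} f bound (suc t) m+t<n = begin
    2 ^ suc t * sumFromTo m (m + suc t) f + N
      ≡⟨ cong (λ j → 2 ^ suc t * sumFromTo m j f + N) (+-suc m t) ⟩
    2 ^ suc t * sumFromTo m (suc (m + t)) f + N
      ≡⟨ cong (λ s → 2 ^ suc t * s + N) (sumFromTo-suc f (m≤m+n m t)) ⟩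
    2 ^ suc t * (S + F) + N
      ≡⟨ solve 4 (λ p s g n → (con 2 :* p) :* (s :+ g) :+ n := con 2 :* (p :* s) :+ ((con 2 :* p) :* g :+ n)) refl (2 ^ t) S F N ⟩
    2 * (2 ^ t * S) + (2 ^ suc t * F + N)
      ≤⟨ +-monoʳ-≤ (2 * (2 ^ t * S)) (+-monoˡ-≤ N last-term) ⟩
    2 * (2 ^ t * S) + (N + N)
      ≡⟨ solve 2 (λ a n → con 2 :* a :+ (n :+ n) := con 2 :* (a :+ n)) refl (2 ^ t * S) N ⟩
    2 * (2 ^ t * S + N)
      ≤⟨ *-monoʳ-≤ 2 (sumFromTo-dyadic f bound t (≤-trans (+-monoʳ-≤ m (n≤1+n t)) m+t<n)) ⟩
    2 * (2 ^ t * N)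
      ≡⟨ sym (*-assoc 2 (2 ^ t) N) ⟩
    2 ^ suc t * N ∎
  where
  open ≤-Reasoning
  S = sumFromTo m (m + t) f
  F = f (m + t)
  last-term : 2 ^ suc t * F ≤ N
  last-term = subst (λ e → 2 ^ suc e * F ≤ N) (m+n∸m≡n m t)
    (bound (m + t) (m≤m+n m t) (≤-trans (≤-reflexive (sym (+-suc m t))) m+t<n))

sumFromTo-<-dyadic : ∀ {m n N} f → m ≤ n → 0 < N →
  (∀ k → m ≤ k → k < n → 2 ^ suc (k ∸ m) * f k ≤ N) → sumFromTo m n f < N
sumFromTo-<-dyadic {m} {n} {N} f m≤n N>0 bound =
  *-cancelˡ-< (2 ^ t) _ _ (begin-strict
    2 ^ t * sumFromTo m n f      <⟨ m<m+n _ N>0 ⟩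
    2 ^ t * sumFromTo m n f + N  ≡⟨ cong (λ j → 2 ^ t * sumFromTo m j f + N) (sym m+t≡n) ⟩
    2 ^ t * sumFromTo m (m + t) f + N ≤⟨ sumFromTo-dyadic f bound t (≤-reflexive m+t≡n) ⟩
    2 ^ t * N ∎)
  where
  open ≤-Reasoning
  t = n ∸ m
  m+t≡n : m + t ≡ n
  m+t≡n = m+[n∸m]≡n m≤n

rising : ℕ → ℕ → ℕ
rising b zero    = 1
rising b (suc a) = (b + suc a) * rising b a

[a+b]!≡rising*b! : ∀ a b → (a + b) ! ≡ rising b a * b !
[a+b]!≡rising*b! zero    b = sym (+-identityʳ _)
[a+b]!≡rising*b! (suc a) b = begin
  suc (a + b) * (a + b) !        ≡⟨ cong (suc (a + b) *_) ([a+b]!≡rising*b! a b) ⟩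
  suc (a + b) * (rising b a * b !) ≡⟨ sym (*-assoc (suc (a + b)) (rising b a) (b !)) ⟩
  suc (a + b) * rising b a * b !   ≡⟨ cong (λ x → x * rising b a * b !) (trans (cong suc (+-comm a b)) (sym (+-suc b a))) ⟩
  (b + suc a) * rising b a * b !   ∎
  where open ≡-Reasoning

j!*[a+b]^j≤a^j*rising : ∀ a b j → j ≤ a → j ! * (a + b) ^ j ≤ a ^ j * rising b j
j!*[a+b]^j≤a^j*rising a b zero    _   = ≤-refl
j!*[a+b]^j≤a^j*rising a b (suc j) j<a = begin
    (suc j * j !) * ((a + b) * (a + b) ^ j)
      ≡⟨ solve 4 (λ i f s p → (i :* f) :* (s :* p) := (i :* s) :* (f :* p)) refl (suc j) (j !) (a + b) ((a + b) ^ j) ⟩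
    (suc j * (a + b)) * (j ! * (a + b) ^ j)
      ≤⟨ *-mono-≤ factor (j!*[a+b]^j≤a^j*rising a b j (<⇒≤ j<a)) ⟩
    (a * (b + suc j)) * (a ^ j * rising b j)
      ≡⟨ solve 4 (λ x y z w → (x :* y) :* (z :* w) := (x :* z) :* (y :* w)) refl a (b + suc j) (a ^ j) (rising b j) ⟩
    (a * a ^ j) * ((b + suc j) * rising b j) ∎
  where
  open ≤-Reasoning
  factor : suc j * (a + b) ≤ a * (b + suc j)
  factor = begin
    suc j * (a + b)       ≡⟨ solve 3 (λ i a b → i :* (a :+ b) := a :* i :+ i :* b) refl (suc j) a b ⟩
    a * suc j + suc j * b ≤⟨ +-monoʳ-≤ (a * suc j) (*-monoˡ-≤ b j<a) ⟩
    a * suc j + a * b     ≡⟨ solve 3 (λ a b i → a :* i :+ a :* b := a :* (b :+ i)) refl a b (suc j) ⟩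
    a * (b + suc j)       ∎

[1+b]^a≤rising : ∀ a b → suc b ^ a ≤ rising b a
[1+b]^a≤rising zero    b = ≤-refl
[1+b]^a≤rising (suc a) b = *-mono-≤ (≤-trans (≤-reflexive (+-comm 1 b)) (+-monoʳ-≤ b (s≤s z≤n))) ([1+b]^a≤rising a b)

-- The binomial bounds C(n,k) ≥ (n/k)^k and C(n,k) ≥ (n-k+1)^k / k!, cleared of denominators.
k!*[n∸k]!*n^k≤k^k*n! : ∀ {k n} → k ≤ n → k ! * (n ∸ k) ! * n ^ k ≤ k ^ k * n !
k!*[n∸k]!*n^k≤k^k*n! {k} {n} k≤n = subst (λ x → k ! * (x ∸ k) ! * x ^ k ≤ k ^ k * x !) (m+[n∸m]≡n k≤n) (begin
    k ! * (k + b ∸ k) ! * (k + b) ^ k ≡⟨ cong (λ x → k ! * x ! * (k + b) ^ k) (m+n∸m≡n k b) ⟩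
    k ! * b ! * (k + b) ^ k           ≡⟨ solve 3 (λ x y z → x :* y :* z := (x :* z) :* y) refl (k !) (b !) ((k + b) ^ k) ⟩
    (k ! * (k + b) ^ k) * b !         ≤⟨ *-monoˡ-≤ (b !) (j!*[a+b]^j≤a^j*rising k b k ≤-refl) ⟩
    (k ^ k * rising b k) * b !        ≡⟨ *-assoc (k ^ k) _ _ ⟩
    k ^ k * (rising b k * b !)        ≡⟨ cong (k ^ k *_) (sym ([a+b]!≡rising*b! k b)) ⟩
    k ^ k * (k + b) !                 ∎)
  where
  open ≤-Reasoning
  b = n ∸ k

k!*[n∸k]!*[1+n∸k]^k≤k!*n! : ∀ {k n} → k ≤ n → k ! * (n ∸ k) ! * suc (n ∸ k) ^ k ≤ k ! * n !
k!*[n∸k]!*[1+n∸k]^k≤k!*n! {k} {n} k≤n = begin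
    k ! * b ! * suc b ^ k   ≡⟨ *-assoc (k !) (b !) _ ⟩
    k ! * (b ! * suc b ^ k) ≤⟨ *-monoʳ-≤ (k !) (*-monoʳ-≤ (b !) ([1+b]^a≤rising k b)) ⟩
    k ! * (b ! * rising b k) ≡⟨ cong (k ! *_) (trans (*-comm (b !) _) (sym ([a+b]!≡rising*b! k b))) ⟩
    k ! * (k + b) !         ≡⟨ cong (λ x → k ! * x !) (m+[n∸m]≡n k≤n) ⟩
    k ! * n !               ∎
  where
  open ≤-Reasoning
  b = n ∸ k

*-cancel-≤-product : ∀ {X G A B c Z M Y F} → 0 < c → 0 < M →
  c * G ≤ Z → A * B * M ≤ Y * F → X * Z * Z * Y ≤ c * c * M → X * (G * G) * A * B ≤ F
*-cancel-≤-product {X} {G} {A} {B} {c} {Z} {M} {Y} {F} c>0 M>0 cG≤Z ABM≤YF XZZY≤ccM =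
  *-cancelʳ-≤ _ _ (c * c * M) {{>-nonZero (*-mono-≤ (*-mono-≤ c>0 c>0) M>0)}} (begin
    X * (G * G) * A * B * (c * c * M)
      ≡⟨ solve 6 (λ X G A B c M → X :* (G :* G) :* A :* B :* (c :* c :* M) := X :* (c :* G) :* (c :* G) :* (A :* B :* M)) refl X G A B c M ⟩
    X * (c * G) * (c * G) * (A * B * M) ≤⟨ *-mono-≤ (*-mono-≤ (*-monoʳ-≤ X cG≤Z) cG≤Z) ABM≤YF ⟩
    X * Z * Z * (Y * F)                 ≡⟨ sym (*-assoc (X * Z * Z) Y F) ⟩
    X * Z * Z * Y * F                   ≤⟨ *-monoˡ-≤ F XZZY≤ccM ⟩
    c * c * M * F                       ≡⟨ *-comm (c * c * M) F ⟩
    F * (c * c * M)                     ∎)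
  where open ≤-Reasoning

-- c is a known factor of the denominator of the Gaussian binomial, Z a bound on its numerator,
-- and Y/M a lower bound on the binomial coefficient N!/(a! (N-a)!), for a = q^k and N = q^(k+d).
w*summand≤ : ∀ q k d {w c Z M Y} → 0 < c → 0 < M →
  c * gaussBinom q (k + d) k ≤ Z →
  (q ^ k) ! * (q ^ (k + d) ∸ q ^ k) ! * M ≤ Y * (q ^ (k + d)) ! →
  w * q ^ (2 * d) * Z * Z * Y ≤ c * c * M →
  w * summand q (k + d) k ≤ (q ^ (k + d)) !
w*summand≤ q k d {w} c>0 M>0 cG≤Z binom powers =
  subst (_≤ (q ^ (k + d)) !) (sym unfold)
    (*-cancel-≤-product {X = w * q ^ (2 * d)} {A = (q ^ k) !} {B = (q ^ (k + d) ∸ q ^ k) !} c>0 M>0 cG≤Z binom powers)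
  where
  G = gaussBinom q (k + d) k
  unfold : w * summand q (k + d) k ≡ w * q ^ (2 * d) * (G * G) * (q ^ k) ! * (q ^ (k + d) ∸ q ^ k) !
  unfold rewrite m+n∸m≡n k d =
    solve 5 (λ w x g a b → w :* (x :* g :* a :* b) := w :* x :* g :* a :* b) refl
      w (q ^ (2 * d)) (G * G) ((q ^ k) !) ((q ^ (k + d) ∸ q ^ k) !)

module _ {q : ℕ} .{{_ : NonZero q}} (k d : ℕ) {w c Z : ℕ} (c>0 : 0 < c) (cG≤Z : c * gaussBinom q (k + d) k ≤ Z) where

  private
    a = q ^ k
    N = q ^ (k + d)
    a≤N : a ≤ N
    a≤N = ^-monoʳ-≤ q (m≤m+n k d)

  w*summand≤-ratio : w * q ^ (2 * d) * Z * Z * a ^ a ≤ c * c * N ^ a → w * summand q (k + d) k ≤ N !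
  w*summand≤-ratio = w*summand≤ q k d {w} {Y = a ^ a} c>0 (m^n>0 N {{m^n≢0 q (k + d)}} a) cG≤Z (k!*[n∸k]!*n^k≤k^k*n! a≤N)

  w*summand≤-shifted : w * q ^ (2 * d) * Z * Z * a ! ≤ c * c * suc (N ∸ a) ^ a → w * summand q (k + d) k ≤ N !
  w*summand≤-shifted = w*summand≤ q k d {w} {Y = a !} c>0 (m^n>0 (suc (N ∸ a)) a) cG≤Z (k!*[n∸k]!*[1+n∸k]^k≤k!*n! a≤N)

exponent-condition : ∀ k {d Q} → 1 ≤ d → 5 * k + 3 ≤ Q → suc k + 2 * d + 2 * (suc d * k) ≤ d * Q
exponent-condition k {suc e} {Q} _ 5k+3≤Q = begin
    suc k + 2 * suc e + 2 * (suc (suc e) * k)                  ≤⟨ m≤m+n _ (3 * e * k + e) ⟩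
    suc k + 2 * suc e + 2 * (suc (suc e) * k) + (3 * e * k + e) ≡⟨ expand e k ⟩
    suc e * (5 * k + 3)                                        ≤⟨ *-monoʳ-≤ (suc e) 5k+3≤Q ⟩
    suc e * Q                                                  ∎
  where
  open ≤-Reasoning
  expand : ∀ e k → suc k + 2 * suc e + 2 * (suc (suc e) * k) + (3 * e * k + e) ≡ suc e * (5 * k + 3)
  expand = solve 2 (λ e k → con 1 :+ k :+ con 2 :* (con 1 :+ e) :+ con 2 :* ((con 2 :+ e) :* k) :+ (con 3 :* e :* k :+ e)
                          := (con 1 :+ e) :* (con 5 :* k :+ con 3)) refl

div*≤ : ∀ m d → m div d * d ≤ m
div*≤ m zero    = z≤n
div*≤ m (suc d) = m/n*n≤m m (suc d)

gaussBinom*denominator≤ : ∀ q n k → gaussBinom q n k * qFallProd q k k ≤ qFallProd q n k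
gaussBinom*denominator≤ q n k = div*≤ (qFallProd q n k) (qFallProd q k k)

module _ {q : ℕ} (1<q : 1 < q) where

  private instance
    q≢0 : NonZero q
    q≢0 = >-nonZero (<-trans z<s 1<q)

  1≤q^[1+e]∸1 : ∀ e → 1 ≤ q ^ suc e ∸ 1
  1≤q^[1+e]∸1 e = m+n≤o⇒m≤o∸n 1 (begin
    2         ≤⟨ m≤m*n 2 (q ^ e) {{m^n≢0 q e}} ⟩
    2 * q ^ e ≤⟨ *-monoˡ-≤ (q ^ e) 1<q ⟩
    q ^ suc e ∎)
    where open ≤-Reasoning

  qFallProd-pos : ∀ {t i} → i ≤ t → 0 < qFallProd q t i
  qFallProd-pos {i = zero}      _   = z<s
  qFallProd-pos {t} {suc i} i<t with t ∸ i | m<n⇒0<n∸m i<t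
  ... | suc e | _ = *-mono-≤ (1≤q^[1+e]∸1 e) (qFallProd-pos (<⇒≤ i<t))

  q^[1+e+d]∸1≤q^[1+d]*[q^[1+e]∸1] : ∀ d e → q ^ (suc e + d) ∸ 1 ≤ q ^ suc d * (q ^ suc e ∸ 1)
  q^[1+e+d]∸1≤q^[1+d]*[q^[1+e]∸1] d e = begin
      q ^ (suc e + d) ∸ 1                    ≤⟨ m∸n≤m _ 1 ⟩
      q * P                                  ≤⟨ m+n≤o⇒m≤o∸n (q * P) enough ⟩
      q ^ suc d * q ^ suc e ∸ q ^ suc d      ≡⟨ cong (q ^ suc d * q ^ suc e ∸_) (sym (*-identityʳ (q ^ suc d))) ⟩
      q ^ suc d * q ^ suc e ∸ q ^ suc d * 1  ≡⟨ sym (*-distribˡ-∸ (q ^ suc d) (q ^ suc e) 1) ⟩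
      q ^ suc d * (q ^ suc e ∸ 1)            ∎
    where
    open ≤-Reasoning
    P = q ^ (e + d)
    enough : q * P + q ^ suc d ≤ q ^ suc d * q ^ suc e
    enough = begin
      q * P + q ^ suc d     ≤⟨ +-monoʳ-≤ (q * P) (*-monoʳ-≤ q (^-monoʳ-≤ q (m≤n+m d e))) ⟩
      q * P + q * P         ≡⟨ solve 1 (λ x → x :+ x := con 2 :* x) refl (q * P) ⟩
      2 * (q * P)           ≤⟨ *-monoˡ-≤ (q * P) 1<q ⟩
      q * (q * P)           ≡⟨ cong (λ x → q * (q * q ^ x)) (+-comm e d) ⟩
      q ^ (suc (suc (d + e))) ≡⟨ cong (q ^_) (cong suc (sym (+-suc d e))) ⟩
      q ^ (suc d + suc e)   ≡⟨ ^-distribˡ-+-* q (suc d) (suc e) ⟩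
      q ^ suc d * q ^ suc e ∎

  qFallProd-+-≤ : ∀ t d {i} → i ≤ t → qFallProd q (t + d) i ≤ q ^ (suc d * i) * qFallProd q t i
  qFallProd-+-≤ t d {zero} _ rewrite *-zeroʳ d = ≤-refl
  qFallProd-+-≤ t d {suc i} i<t = begin
      (q ^ (t + d ∸ i) ∸ 1) * qFallProd q (t + d) i
        ≤⟨ *-mono-≤ factor (qFallProd-+-≤ t d (<⇒≤ i<t)) ⟩
      (q ^ suc d * (q ^ (t ∸ i) ∸ 1)) * (q ^ (suc d * i) * qFallProd q t i)
        ≡⟨ solve 4 (λ a b c x → (a :* b) :* (c :* x) := (a :* c) :* (b :* x)) refl (q ^ suc d) (q ^ (t ∸ i) ∸ 1) (q ^ (suc d * i)) (qFallProd q t i) ⟩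
      (q ^ suc d * q ^ (suc d * i)) * ((q ^ (t ∸ i) ∸ 1) * qFallProd q t i)
        ≡⟨ cong (_* ((q ^ (t ∸ i) ∸ 1) * qFallProd q t i)) (trans (sym (^-distribˡ-+-* q (suc d) (suc d * i))) (cong (q ^_) (sym (*-suc (suc d) i)))) ⟩
      q ^ (suc d * suc i) * ((q ^ (t ∸ i) ∸ 1) * qFallProd q t i) ∎
    where
    open ≤-Reasoning
    factor : q ^ (t + d ∸ i) ∸ 1 ≤ q ^ suc d * (q ^ (t ∸ i) ∸ 1)
    factor with t ∸ i | +-∸-comm d (<⇒≤ i<t) | m<n⇒0<n∸m i<t
    ... | suc e | t+d∸i≡e+d | _ rewrite t+d∸i≡e+d = q^[1+e+d]∸1≤q^[1+d]*[q^[1+e]∸1] d e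

  gaussBinom-≤ : ∀ k d → gaussBinom q (k + d) k ≤ q ^ (suc d * k)
  gaussBinom-≤ k d = *-cancelʳ-≤ _ _ D {{>-nonZero (qFallProd-pos {k} ≤-refl)}} (begin
      gaussBinom q (k + d) k * D ≤⟨ gaussBinom*denominator≤ q (k + d) k ⟩
      qFallProd q (k + d) k      ≤⟨ qFallProd-+-≤ k d ≤-refl ⟩
      q ^ (suc d * k) * D        ∎)
    where
    open ≤-Reasoning
    D = qFallProd q k k

  -- With G ≤ q^((1+d)k) and C(N,a) ≥ q^(da), everything becomes a comparison of exponents of q.
  w*summand≤-generic : ∀ k d {w} → w ≤ q ^ suc k → suc k + 2 * d + 2 * (suc d * k) ≤ d * q ^ k →
    w * summand q (k + d) k ≤ (q ^ (k + d)) !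
  w*summand≤-generic k d {w} w≤ exponents =
    w*summand≤-ratio k d {w} {1} {q ^ s} z<s (≤-trans (≤-reflexive (*-identityˡ _)) (gaussBinom-≤ k d)) (begin
      w * q ^ (2 * d) * q ^ s * q ^ s * a ^ a
        ≤⟨ *-monoˡ-≤ (a ^ a) (*-monoˡ-≤ (q ^ s) (*-monoˡ-≤ (q ^ s) (*-monoˡ-≤ (q ^ (2 * d)) w≤))) ⟩
      q ^ suc k * q ^ (2 * d) * q ^ s * q ^ s * a ^ a
        ≡⟨ cong (q ^ suc k * q ^ (2 * d) * q ^ s * q ^ s *_) (^-*-assoc q k a) ⟩
      q ^ suc k * q ^ (2 * d) * q ^ s * q ^ s * q ^ (k * a)
        ≡⟨ collect ⟩
      q ^ (suc k + 2 * d + s + s + k * a)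
        ≤⟨ ^-monoʳ-≤ q total ⟩
      q ^ ((k + d) * a)
        ≡⟨ sym (^-*-assoc q (k + d) a) ⟩
      (q ^ (k + d)) ^ a
        ≡⟨ sym (+-identityʳ _) ⟩
      1 * 1 * (q ^ (k + d)) ^ a ∎)
    where
    open ≤-Reasoning
    a = q ^ k
    s = suc d * k
    pw : ∀ x y → q ^ x * q ^ y ≡ q ^ (x + y)
    pw x y = sym (^-distribˡ-+-* q x y)
    collect : q ^ suc k * q ^ (2 * d) * q ^ s * q ^ s * q ^ (k * a) ≡ q ^ (suc k + 2 * d + s + s + k * a)
    collect = begin-equality
      q ^ suc k * q ^ (2 * d) * q ^ s * q ^ s * q ^ (k * a) ≡⟨ cong (λ x → x * q ^ s * q ^ s * q ^ (k * a)) (pw (suc k) (2 * d)) ⟩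
      q ^ (suc k + 2 * d) * q ^ s * q ^ s * q ^ (k * a)     ≡⟨ cong (λ x → x * q ^ s * q ^ (k * a)) (pw (suc k + 2 * d) s) ⟩
      q ^ (suc k + 2 * d + s) * q ^ s * q ^ (k * a)         ≡⟨ cong (_* q ^ (k * a)) (pw (suc k + 2 * d + s) s) ⟩
      q ^ (suc k + 2 * d + s + s) * q ^ (k * a)             ≡⟨ pw (suc k + 2 * d + s + s) (k * a) ⟩
      q ^ (suc k + 2 * d + s + s + k * a)                   ∎
    total : suc k + 2 * d + s + s + k * a ≤ (k + d) * a
    total = begin
      suc k + 2 * d + s + s + k * a ≡⟨ solve 4 (λ k d s kA → k :+ con 2 :* d :+ s :+ s :+ kA := kA :+ (k :+ con 2 :* d :+ con 2 :* s)) refl (suc k) d s (k * a) ⟩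
      k * a + (suc k + 2 * d + 2 * s) ≤⟨ +-monoʳ-≤ (k * a) exponents ⟩
      k * a + d * a                   ≡⟨ sym (*-distribʳ-+ a k d) ⟩
      (k + d) * a                     ∎

  2^[1+k∸m]≤q^[1+k] : ∀ k m → 2 ^ suc (k ∸ m) ≤ q ^ suc k
  2^[1+k∸m]≤q^[1+k] k m = ≤-trans (^-monoˡ-≤ (suc (k ∸ m)) 1<q) (^-monoʳ-≤ q (s≤s (m∸n≤m k m)))

  2^[1+k∸m]*summand≤ : ∀ m k d → 1 ≤ d → 5 * k + 3 ≤ q ^ k → 2 ^ suc (k ∸ m) * summand q (k + d) k ≤ (q ^ (k + d)) !
  2^[1+k∸m]*summand≤ m k d 1≤d 5k+3≤ =
    w*summand≤-generic k d (2^[1+k∸m]≤q^[1+k] k m) (exponent-condition k 1≤d 5k+3≤)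

[m*n]^o≡m^o*n^o : ∀ m n o → (m * n) ^ o ≡ m ^ o * n ^ o
[m*n]^o≡m^o*n^o m n zero    = refl
[m*n]^o≡m^o*n^o m n (suc o) = begin
  m * n * (m * n) ^ o       ≡⟨ cong (m * n *_) ([m*n]^o≡m^o*n^o m n o) ⟩
  m * n * (m ^ o * n ^ o)   ≡⟨ solve 4 (λ a b c d → a :* b :* (c :* d) := a :* c :* (b :* d)) refl m n (m ^ o) (n ^ o) ⟩
  m * m ^ o * (n * n ^ o)   ∎
  where open ≡-Reasoning

*-^-scale-≤ : ∀ j {a b K L P M} .{{_ : NonZero a}} → a * P ≤ b * M → K * b ^ j ≤ a ^ j * L → K * P ^ j ≤ L * M ^ j
*-^-scale-≤ j {a} {b} {K} {L} {P} {M} aP≤bM constants = *-cancelˡ-≤ (a ^ j) {{m^n≢0 a j}} (begin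
  a ^ j * (K * P ^ j)   ≡⟨ solve 3 (λ x y z → x :* (y :* z) := y :* (x :* z)) refl (a ^ j) K (P ^ j) ⟩
  K * (a ^ j * P ^ j)   ≡⟨ cong (K *_) (sym ([m*n]^o≡m^o*n^o a P j)) ⟩
  K * (a * P) ^ j       ≤⟨ *-monoʳ-≤ K (^-monoˡ-≤ j aP≤bM) ⟩
  K * (b * M) ^ j       ≡⟨ cong (K *_) ([m*n]^o≡m^o*n^o b M j) ⟩
  K * (b ^ j * M ^ j)   ≡⟨ sym (*-assoc K (b ^ j) (M ^ j)) ⟩
  K * b ^ j * M ^ j     ≤⟨ *-monoˡ-≤ (M ^ j) constants ⟩
  a ^ j * L * M ^ j     ≡⟨ *-assoc (a ^ j) L (M ^ j) ⟩
  a ^ j * (L * M ^ j)   ∎)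
  where open ≤-Reasoning

q^[2*d]≡q^d*q^d : ∀ q d → q ^ (2 * d) ≡ q ^ d * q ^ d
q^[2*d]≡q^d*q^d q d = trans (cong (λ x → q ^ (d + x)) (+-identityʳ d)) (^-distribˡ-+-* q d d)

-- q = 2, k = 3: here [n 3]_2 ≤ 2^(3n-3)/21, and C(2^n, 8) ≥ (2^n - 7)^8 / 8!.
2*summand[q≡2,k≡3] : ∀ {d} → 4 ≤ d → 2 * summand 2 (3 + d) 3 ≤ (2 ^ (3 + d)) !
2*summand[q≡2,k≡3] {d@(suc (suc (suc (suc e))))} (s≤s (s≤s (s≤s (s≤s z≤n)))) =
  w*summand≤-shifted 3 d {2} {21} {Z} z<s cG≤Z (begin
    2 * 2 ^ (2 * d) * Z * Z * 40320         ≡⟨ cong (λ x → 2 * x * Z * Z * 40320) (q^[2*d]≡q^d*q^d 2 d) ⟩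
    2 * (P * P) * Z * Z * 40320             ≡⟨ collect P 2 64 40320 ⟩
    2 * 64 * 64 * 40320 * P ^ 8             ≤⟨ *-^-scale-≤ 8 {32} {5} {2 * 64 * 64 * 40320} {21 * 21} {P} {M} 32P≤5M (≤ᵇ⇒≤ _ _ _) ⟩
    21 * 21 * M ^ 8                         ∎)
  where
  open ≤-Reasoning
  collect : ∀ P a b f → a * (P * P) * (b * (P * (P * P))) * (b * (P * (P * P))) * f ≡ a * b * b * f * P ^ 8
  collect = solve 4 (λ P a b f → a :* (P :* P) :* (b :* (P :* (P :* P))) :* (b :* (P :* (P :* P))) :* f := a :* b :* b :* f :* (P :^ 8)) refl
  P = 2 ^ d
  Z = 64 * (P * (P * P))
  cG≤Z : 21 * gaussBinom 2 (3 + d) 3 ≤ Z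
  cG≤Z = begin
    21 * gaussBinom 2 (3 + d) 3 ≡⟨ *-comm 21 (gaussBinom 2 (3 + d) 3) ⟩
    gaussBinom 2 (3 + d) 3 * 21 ≤⟨ gaussBinom*denominator≤ 2 (3 + d) 3 ⟩
    qFallProd 2 (3 + d) 3       ≤⟨ *-mono-≤ (m∸n≤m (2 * P) 1) (*-mono-≤ (m∸n≤m (2 * (2 * P)) 1) (*-mono-≤ (m∸n≤m (2 * (2 * (2 * P))) 1) ≤-refl)) ⟩
    2 * P * (2 * (2 * P) * (2 * (2 * (2 * P)) * 1)) ≡⟨ solve 1 (λ P → con 2 :* P :* (con 2 :* (con 2 :* P) :* (con 2 :* (con 2 :* (con 2 :* P)) :* con 1))
                                                                 := con 64 :* (P :* (P :* P))) refl P ⟩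
    Z                           ∎
  M = suc (2 ^ (3 + d) ∸ 8)
  M+7≡8P : M + 7 ≡ 8 * P
  M+7≡8P = begin-equality
    suc (2 ^ (3 + d) ∸ 8) + 7 ≡⟨ +-comm (suc (2 ^ (3 + d) ∸ 8)) 7 ⟩
    8 + (2 ^ (3 + d) ∸ 8)     ≡⟨ m+[n∸m]≡n (^-monoʳ-≤ 2 (m≤m+n 3 d)) ⟩
    2 ^ (3 + d)               ≡⟨ ^-distribˡ-+-* 2 3 d ⟩
    8 * P                     ∎
  32P≤5M : 32 * P ≤ 5 * M
  32P≤5M = +-cancelʳ-≤ 35 _ _ (begin
    32 * P + 35     ≤⟨ +-monoʳ-≤ (32 * P) (≤-trans (≤ᵇ⇒≤ 35 128 _) (*-monoʳ-≤ 8 (^-monoʳ-≤ 2 (m≤m+n 4 e)))) ⟩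
    32 * P + 8 * P  ≡⟨ solve 1 (λ P → con 32 :* P :+ con 8 :* P := con 5 :* (con 8 :* P)) refl P ⟩
    5 * (8 * P)     ≡⟨ cong (5 *_) (sym M+7≡8P) ⟩
    5 * (M + 7)     ≡⟨ *-distribˡ-+ 5 M 7 ⟩
    5 * M + 35      ∎)

-- q = 4, k = 1: here C(4^n, 4) ≥ (4^n - 3)^4 / 4!.
2*summand[q≡4,k≡1] : ∀ {d} → 1 ≤ d → 2 * summand 4 (1 + d) 1 ≤ (4 ^ (1 + d)) !
2*summand[q≡4,k≡1] {d@(suc e)} _ =
  w*summand≤-shifted 1 d {2} {3} {4 * P} z<s cG≤Z (begin
    2 * 4 ^ (2 * d) * (4 * P) * (4 * P) * 24 ≡⟨ cong (λ x → 2 * x * (4 * P) * (4 * P) * 24) (q^[2*d]≡q^d*q^d 4 d) ⟩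
    2 * (P * P) * (4 * P) * (4 * P) * 24     ≡⟨ collect P 2 4 24 ⟩
    2 * 4 * 4 * 24 * P ^ 4                   ≤⟨ *-^-scale-≤ 4 {52} {16} {2 * 4 * 4 * 24} {3 * 3} {P} {M} 52P≤16M (≤ᵇ⇒≤ _ _ _) ⟩
    3 * 3 * M ^ 4                            ∎)
  where
  open ≤-Reasoning
  collect : ∀ P a b f → a * (P * P) * (b * P) * (b * P) * f ≡ a * b * b * f * P ^ 4
  collect = solve 4 (λ P a b f → a :* (P :* P) :* (b :* P) :* (b :* P) :* f := a :* b :* b :* f :* (P :^ 4)) refl
  P = 4 ^ d
  cG≤Z : 3 * gaussBinom 4 (1 + d) 1 ≤ 4 * P
  cG≤Z = begin
    3 * gaussBinom 4 (1 + d) 1 ≡⟨ *-comm 3 (gaussBinom 4 (1 + d) 1) ⟩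
    gaussBinom 4 (1 + d) 1 * 3 ≤⟨ gaussBinom*denominator≤ 4 (1 + d) 1 ⟩
    (4 * P ∸ 1) * 1            ≤⟨ *-monoˡ-≤ 1 (m∸n≤m (4 * P) 1) ⟩
    4 * P * 1                  ≡⟨ *-identityʳ (4 * P) ⟩
    4 * P                      ∎
  M = suc (4 ^ (1 + d) ∸ 4)
  M+3≡4P : M + 3 ≡ 4 * P
  M+3≡4P = begin-equality
    suc (4 ^ (1 + d) ∸ 4) + 3 ≡⟨ +-comm (suc (4 ^ (1 + d) ∸ 4)) 3 ⟩
    4 + (4 ^ (1 + d) ∸ 4)     ≡⟨ m+[n∸m]≡n (^-monoʳ-≤ 4 (s≤s (z≤n {d}))) ⟩
    4 * P                     ∎
  52P≤16M : 52 * P ≤ 16 * M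
  52P≤16M = +-cancelʳ-≤ 48 _ _ (begin
    52 * P + 48      ≤⟨ +-monoʳ-≤ (52 * P) (*-monoʳ-≤ 12 (^-monoʳ-≤ 4 (s≤s (z≤n {e})))) ⟩
    52 * P + 12 * P  ≡⟨ solve 1 (λ P → con 52 :* P :+ con 12 :* P := con 16 :* (con 4 :* P)) refl P ⟩
    16 * (4 * P)     ≡⟨ cong (16 *_) (sym M+3≡4P) ⟩
    16 * (M + 3)     ≡⟨ *-distribˡ-+ 16 M 3 ⟩
    16 * M + 48      ∎)

-- q ≥ 5, k = 1: the factor q - 1 = [1 1]_q of the denominator pays for the weight 2.
2*summand[q≥5,k≡1] : ∀ {q d} → 5 ≤ q → 1 ≤ d → 2 * summand q (1 + d) 1 ≤ (q ^ (1 + d)) !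
2*summand[q≥5,k≡1] {q@(suc p)} {d} 5≤q 1≤d =
  w*summand≤-ratio 1 d {2} {c} {q ^ (1 + d)} 0<c cG≤Z (begin
    2 * q ^ (2 * d) * Z * Z * (q ^ 1) ^ (q ^ 1) ≡⟨ cong (λ x → 2 * q ^ (2 * d) * Z * Z * x ^ x) (*-identityʳ q) ⟩
    2 * q ^ (2 * d) * Z * Z * q ^ q             ≡⟨ collect ⟩
    (2 * q) * q ^ (4 * d + 1 + q)               ≤⟨ *-mono-≤ 2q≤cc (^-monoʳ-≤ q exponents) ⟩
    c * c * q ^ ((1 + d) * q)                   ≡⟨ cong (λ x → c * c * x) (sym (^-*-assoc q (1 + d) q)) ⟩
    c * c * (q ^ (1 + d)) ^ q                   ≡⟨ cong (λ x → c * c * (q ^ (1 + d)) ^ x) (sym (*-identityʳ q)) ⟩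
    c * c * (q ^ (1 + d)) ^ (q ^ 1)             ∎)
  where
  open ≤-Reasoning
  c = qFallProd q 1 1
  Z = q ^ (1 + d)
  c≡p : c ≡ p
  c≡p = trans (*-identityʳ _) (cong (_∸ 1) (*-identityʳ q))
  0<c : 0 < c
  0<c = subst (0 <_) (sym c≡p) (≤-trans (s≤s z≤n) (≤-pred 5≤q))
  cG≤Z : c * gaussBinom q (1 + d) 1 ≤ Z
  cG≤Z = begin
    c * gaussBinom q (1 + d) 1 ≡⟨ *-comm c (gaussBinom q (1 + d) 1) ⟩
    gaussBinom q (1 + d) 1 * c ≤⟨ gaussBinom*denominator≤ q (1 + d) 1 ⟩
    (Z ∸ 1) * 1                ≤⟨ *-monoˡ-≤ 1 (m∸n≤m Z 1) ⟩
    Z * 1                      ≡⟨ *-identityʳ Z ⟩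
    Z                          ∎
  2q≤cc : 2 * q ≤ c * c
  2q≤cc = subst (λ x → 2 * q ≤ x * x) (sym c≡p) (begin
    2 * suc p      ≡⟨ *-distribˡ-+ 2 1 p ⟩
    2 + 2 * p      ≤⟨ +-monoˡ-≤ (2 * p) (*-monoʳ-≤ 2 (≤-trans (s≤s z≤n) 4≤p)) ⟩
    2 * p + 2 * p  ≡⟨ solve 1 (λ p → con 2 :* p :+ con 2 :* p := con 4 :* p) refl p ⟩
    4 * p          ≤⟨ *-monoˡ-≤ p 4≤p ⟩
    p * p          ∎)
    where 4≤p = ≤-pred 5≤q
  exponents : 4 * d + 1 + q ≤ (1 + d) * q
  exponents = begin
    4 * d + 1 + q ≡⟨ +-comm (4 * d + 1) q ⟩
    q + (4 * d + 1) ≤⟨ +-monoʳ-≤ q (+-monoʳ-≤ (4 * d) 1≤d) ⟩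
    q + (4 * d + d) ≡⟨ cong (q +_) (solve 1 (λ d → con 4 :* d :+ d := d :* con 5) refl d) ⟩
    q + d * 5       ≤⟨ +-monoʳ-≤ q (*-monoʳ-≤ d 5≤q) ⟩
    q + d * q       ∎
  collect : 2 * q ^ (2 * d) * Z * Z * q ^ q ≡ (2 * q) * q ^ (4 * d + 1 + q)
  collect = begin-equality
    2 * q ^ (2 * d) * Z * Z * q ^ q                ≡⟨ solve 5 (λ t a b c x → t :* a :* b :* c :* x := t :* (a :* b :* c :* x)) refl 2 (q ^ (2 * d)) Z Z (q ^ q) ⟩
    2 * (q ^ (2 * d) * Z * Z * q ^ q)              ≡⟨ cong (λ x → 2 * (x * Z * q ^ q)) (sym (^-distribˡ-+-* q (2 * d) (1 + d))) ⟩
    2 * (q ^ (2 * d + (1 + d)) * Z * q ^ q)        ≡⟨ cong (λ x → 2 * (x * q ^ q)) (sym (^-distribˡ-+-* q (2 * d + (1 + d)) (1 + d))) ⟩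
    2 * (q ^ (2 * d + (1 + d) + (1 + d)) * q ^ q)  ≡⟨ cong (2 *_) (sym (^-distribˡ-+-* q (2 * d + (1 + d) + (1 + d)) q)) ⟩
    2 * q ^ (2 * d + (1 + d) + (1 + d) + q)        ≡⟨ cong (λ x → 2 * q ^ x) (solve 2 (λ d q → con 2 :* d :+ (con 1 :+ d) :+ (con 1 :+ d) :+ q := con 1 :+ (con 4 :* d :+ con 1 :+ q)) refl d q) ⟩
    2 * (q * q ^ (4 * d + 1 + q))                  ≡⟨ sym (*-assoc 2 q _) ⟩
    2 * q * q ^ (4 * d + 1 + q)                    ∎

2*summand[q≥4,k≡1] : ∀ {q d} → 4 ≤ q → 1 ≤ d → 2 * summand q (1 + d) 1 ≤ (q ^ (1 + d)) !
2*summand[q≥4,k≡1] 4≤q 1≤d with m≤n⇒m<n∨m≡n 4≤q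
... | inj₁ 4<q  = 2*summand[q≥5,k≡1] 4<q 1≤d
... | inj₂ refl = 2*summand[q≡4,k≡1] 1≤d

5k+3≤q^k : ∀ {q j k} → 1 < q → 1 ≤ j → 5 * j + 3 ≤ q ^ j → j ≤ k → 5 * k + 3 ≤ q ^ k
5k+3≤q^k {q} {j} 1<q 1≤j base = go ∘ ≤⇒≤′
  where
  go : ∀ {k} → j ≤′ k → 5 * k + 3 ≤ q ^ k
  go ≤′-refl               = base
  go {suc k} (≤′-step j≤k) = begin
    5 * suc k + 3          ≡⟨ solve 1 (λ k → con 5 :* (con 1 :+ k) :+ con 3 := con 5 :+ (con 5 :* k :+ con 3)) refl k ⟩
    5 + (5 * k + 3)        ≤⟨ +-mono-≤ 5≤5k+3 ≤-refl ⟩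
    (5 * k + 3) + (5 * k + 3) ≤⟨ +-mono-≤ (go j≤k) (go j≤k) ⟩
    q ^ k + q ^ k          ≡⟨ solve 1 (λ x → x :+ x := con 2 :* x) refl (q ^ k) ⟩
    2 * q ^ k              ≤⟨ *-monoˡ-≤ (q ^ k) 1<q ⟩
    q ^ suc k              ∎
    where
    open ≤-Reasoning
    5≤5k+3 : 5 ≤ 5 * k + 3
    5≤5k+3 = ≤-trans (*-monoʳ-≤ 5 (≤-trans 1≤j (≤′⇒≤ j≤k))) (m≤m+n (5 * k) 3)

sumFromTo-summand<! : ∀ q m n → m ≤ n →
  (∀ k d → m ≤ k → 1 ≤ d → k + d ≡ n → 2 ^ suc (k ∸ m) * summand q (k + d) k ≤ (q ^ (k + d)) !) →
  sumFromTo m n (summand q n) < (q ^ n) !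
sumFromTo-summand<! q m n m≤n term = sumFromTo-<-dyadic (summand q n) m≤n (1≤n! (q ^ n)) bound
  where
  bound : ∀ k → m ≤ k → k < n → 2 ^ suc (k ∸ m) * summand q n k ≤ (q ^ n) !
  bound k m≤k k<n = subst (λ x → 2 ^ suc (k ∸ m) * summand q x k ≤ (q ^ x) !) k+d≡n
      (term k (n ∸ k) m≤k (m<n⇒0<n∸m k<n) k+d≡n)
    where
    k+d≡n : k + (n ∸ k) ≡ n
    k+d≡n = m+[n∸m]≡n (<⇒≤ k<n)

sum<![q≡2] : ∀ {n} → 3 < n → sumFromTo 3 n (summand 2 n) < (2 ^ n) !
sum<![q≡2] {1} (s≤s ())
sum<![q≡2] {2} (s≤s (s≤s ()))
sum<![q≡2] {3} (s≤s (s≤s (s≤s ())))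
sum<![q≡2] {4} _ = <ᵇ⇒< _ _ _
sum<![q≡2] {5} _ = <ᵇ⇒< _ _ _
sum<![q≡2] {6} _ = <ᵇ⇒< _ _ _
sum<![q≡2] {n@(suc (suc (suc (suc (suc (suc (suc x)))))))} 3<n = sumFromTo-summand<! 2 3 n (<⇒≤ 3<n) term
  where
  1<2 : 1 < 2
  1<2 = ≤-refl
  term : ∀ k d → 3 ≤ k → 1 ≤ d → k + d ≡ n → 2 ^ suc (k ∸ 3) * summand 2 (k + d) k ≤ (2 ^ (k + d)) !
  term 1 _ (s≤s ()) _ _
  term 2 _ (s≤s (s≤s ())) _ _
  term 3 d _ _ k+d≡n rewrite +-cancelˡ-≡ 3 d (4 + x) k+d≡n = 2*summand[q≡2,k≡3] (m≤m+n 4 x)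
  term 4 d _ _ k+d≡n rewrite +-cancelˡ-≡ 4 d (3 + x) k+d≡n =
    w*summand≤-generic 1<2 4 (3 + x) (2^[1+k∸m]≤q^[1+k] 1<2 4 3) exponents
    where
    exponents : 5 + 2 * (3 + x) + 2 * ((4 + x) * 4) ≤ (3 + x) * 16
    exponents = ≤-trans (m≤m+n _ (5 + 6 * x)) (≤-reflexive (solve 1 (λ x →
      con 5 :+ con 2 :* (con 3 :+ x) :+ con 2 :* ((con 4 :+ x) :* con 4) :+ (con 5 :+ con 6 :* x) := (con 3 :+ x) :* con 16) refl x))
  term k@(suc (suc (suc (suc (suc _))))) d _ 1≤d _ =
    2^[1+k∸m]*summand≤ 1<2 3 k d 1≤d (5k+3≤q^k 1<2 (s≤s z≤n) (≤ᵇ⇒≤ 28 32 _) (s≤s (s≤s (s≤s (s≤s (s≤s z≤n))))))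

sum<![q≡3] : ∀ {n} → 2 < n → sumFromTo 2 n (summand 3 n) < (3 ^ n) !
sum<![q≡3] {1} (s≤s ())
sum<![q≡3] {2} (s≤s (s≤s ()))
sum<![q≡3] {3} _ = <ᵇ⇒< _ _ _
sum<![q≡3] {4} _ = <ᵇ⇒< _ _ _
sum<![q≡3] {n@(suc (suc (suc (suc (suc x)))))} 2<n = sumFromTo-summand<! 3 2 n (<⇒≤ 2<n) term
  where
  1<3 : 1 < 3
  1<3 = s≤s (s≤s z≤n)
  term : ∀ k d → 2 ≤ k → 1 ≤ d → k + d ≡ n → 2 ^ suc (k ∸ 2) * summand 3 (k + d) k ≤ (3 ^ (k + d)) !
  term 1 _ (s≤s ()) _ _
  term 2 d _ _ k+d≡n rewrite +-cancelˡ-≡ 2 d (3 + x) k+d≡n =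
    w*summand≤-generic 1<3 2 (3 + x) (2^[1+k∸m]≤q^[1+k] 1<3 2 2) exponents
    where
    exponents : 3 + 2 * (3 + x) + 2 * ((4 + x) * 2) ≤ (3 + x) * 9
    exponents = ≤-trans (m≤m+n _ (2 + 3 * x)) (≤-reflexive (solve 1 (λ x →
      con 3 :+ con 2 :* (con 3 :+ x) :+ con 2 :* ((con 4 :+ x) :* con 2) :+ (con 2 :+ con 3 :* x) := (con 3 :+ x) :* con 9) refl x))
  term k@(suc (suc (suc _))) d _ 1≤d _ =
    2^[1+k∸m]*summand≤ 1<3 2 k d 1≤d (5k+3≤q^k 1<3 (s≤s z≤n) (≤ᵇ⇒≤ 18 27 _) (s≤s (s≤s (s≤s z≤n))))

sum<![q≥4] : ∀ {q n} → 4 ≤ q → 1 < n → sumFromTo 1 n (summand q n) < (q ^ n) !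
sum<![q≥4] {q} {n} 4≤q 1<n = sumFromTo-summand<! q 1 n (<⇒≤ 1<n) term
  where
  1<q : 1 < q
  1<q = ≤-trans (s≤s (s≤s z≤n)) 4≤q
  term : ∀ k d → 1 ≤ k → 1 ≤ d → k + d ≡ n → 2 ^ suc (k ∸ 1) * summand q (k + d) k ≤ (q ^ (k + d)) !
  term 1 d _ 1≤d _ = 2*summand[q≥4,k≡1] 4≤q 1≤d
  term k@(suc (suc _)) d _ 1≤d _ =
    2^[1+k∸m]*summand≤ 1<q 1 k d 1≤d (5k+3≤q^k 1<q (s≤s z≤n) (≤-trans (≤ᵇ⇒≤ 13 16 _) (^-monoˡ-≤ 2 4≤q)) (s≤s (s≤s z≤n)))

theorem2p3 : (q m n : ℕ) → m < n →
    ((q ≡ 2 × m ≡ 3) ⊎ (q ≡ 3 × m ≡ 2) ⊎ (4 ≤ q × m ≡ 1)) →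
    sumFromTo m n (summand q n) < (q ^ n) !
theorem2p3 .2 .3 n m<n (inj₁ (refl , refl))               = sum<![q≡2] m<n
theorem2p3 .3 .2 n m<n (inj₂ (inj₁ (refl , refl)))        = sum<![q≡3] m<n
theorem2p3 q  .1 n m<n (inj₂ (inj₂ (4≤q , refl)))         = sum<![q≥4] 4≤q m<n
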